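{- For every integer $t\geq 1$, the following identity of formal power series in $q$ holds: \[ P_t(q) = \left(\frac{1}{(1-q)(1-q^2)\cdots(1-q^t)} - 1\right) \cdot \frac{1}{1-q^t}. \]
   Context: A partition of a non-negative integer $n$ is a weakly decreasing finite sequence $\lambda_1\geq\cdots\geq\lambda_k>0$ of positive integers with $\lambda_1+\cdots+\lambda_k=n$; write $|\lambda|=n$. For an integer $t\geq 0$, a non-empty partition has bounded difference $t$ if its largest part minus its smallest part is at most $t$. Let $p(n,t)$ be the number of non-empty partitions of $n$ with bounded difference $t$, and $P_t(q)=\sum_{n\geq 1}p(n,t)q^n$. -}

module Defs where

open import Data.Nat as ℕ using (ℕ; zero; suc; _≤_; _<_; _≥_; _∸_; _⊔_; _⊓_; _≤?_)
open import Data.Integer as ℤ using (ℤ; +_; _+_; _*_; -_; _-_)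
open import Data.List using (List)
open import Data.Nat.ListAction using (sum)
open import Data.List.NonEmpty using (List⁺; toList; foldr₁)
open import Data.List.Relation.Unary.All using (All)
open import Data.List.Relation.Unary.Linked using (Linked)
open import Relation.Binary.PropositionalEquality using (_≡_)
open import Relation.Nullary.Decidable using (does)
open import Data.Bool using (if_then_else_)

record NonEmptyPartition (n : ℕ) : Set where
  constructor mkPartition
  field
    parts      : List⁺ ℕ
    positive   : All (λ x → 1 ≤ x) (toList parts)
    decreasing : Linked _≥_ (toList parts)
    sums       : sum (toList parts) ≡ n

open NonEmptyPartition public

largestPart : ∀ {n} → NonEmptyPartition n → ℕ
largestPart λ' = foldr₁ _⊔_ (parts λ')

smallestPart : ∀ {n} → NonEmptyPartition n → ℕ
smallestPart λ' = foldr₁ _⊓_ (parts λ')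

record BDPartition (n t : ℕ) : Set where
  constructor mkBD
  field
    partition : NonEmptyPartition n
    bounded   : largestPart partition ∸ smallestPart partition ≤ t

FPS : Set
FPS = ℕ → ℤ

Σ≤ : ℕ → (ℕ → ℤ) → ℤ
Σ≤ zero    f = f zero
Σ≤ (suc n) f = Σ≤ n f + f (suc n)

Σ1≤ : ℕ → (ℕ → ℤ) → ℤ
Σ1≤ zero    f = + 0
Σ1≤ (suc n) f = Σ1≤ n f + f (suc n)

oneS : FPS
oneS zero    = + 1
oneS (suc _) = + 0

qPow : ℕ → FPS
qPow k n = if does (k ℕ.≟ n) then + 1 else + 0

_⊕_ : FPS → FPS → FPS
(f ⊕ g) n = f n + g n

_⊖_ : FPS → FPS → FPS
(f ⊖ g) n = f n - g n

_⊛_ : FPS → FPS → FPS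
(f ⊛ g) n = Σ≤ n (λ k → f k * g (n ∸ k))

∏1≤ : ℕ → (ℕ → FPS) → FPS
∏1≤ zero    f = oneS
∏1≤ (suc t) f = ∏1≤ t f ⊛ f (suc t)

-- Multiplicative inverse of a series with constant term 1:
-- g 0 = 1,  g m = - Σ_{k=1}^{m} f k * g (m - k).
-- invAux f n agrees with the inverse on all indices ≤ n.
invAux : FPS → ℕ → FPS
invAux f zero    = λ _ → + 1
invAux f (suc n) = λ m → if does (m ≤? n) then invAux f n m
                          else - Σ1≤ m (λ k → f k * invAux f n (m ∸ k))

inv : FPS → FPS
inv f m = invAux f m m

RHS : ℕ → FPS
RHS t = (inv (∏1≤ t (λ i → oneS ⊖ qPow i)) ⊖ oneS) ⊛ inv (oneS ⊖ qPow t)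

-- Let I_t = 1/((1-q)(1-q^2)⋯(1-q^t)), which counts partitions with all parts ≤ t.
-- Multiplying out, I_{t+1}(1 - q^{t+1}) = I_t and RHS_t (1 - q^t) = I_t - 1, so the
-- coefficients obey I_{t+1}[n] = I_t[n] + I_{t+1}[n - t - 1] and
-- RHS_t[n] = (I_t - 1)[n] + RHS_t[n - t].  Both recursions have bijective counterparts:
-- a partition with parts ≤ t + 1 either has parts ≤ t or has a part t + 1 that can be
-- removed; a bounded-difference partition of n > 0 either has largest part h ≤ t, so
-- is a non-empty partition with parts ≤ t, or h > t, and replacing h by h - t gives a
-- bounded-difference partition of n - t in which h - t is the smallest part (all parts
-- are ≥ h - t).  Strong induction on n turns the recursions into the counts.

module Submission where

open import Defs
open import Data.Nat using (ℕ; _≤_)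
open import Data.Integer using (+_)
open import Data.Fin using (Fin)
open import Data.Product using (Σ; _×_)
open import Function.Bundles using (_↔_)
open import Relation.Binary.PropositionalEquality using (_≡_)

open import Data.Nat as ℕ using (zero; suc; _<_; _≥_; _∸_; _⊔_; _⊓_; _≤?_; z≤n; s≤s)
import Data.Nat.Properties as ℕₚ
open import Data.Integer as ℤ using (ℤ)
import Data.Integer.Properties as ℤₚ
open import Data.Bool using (true; false; T; if_then_else_)
open import Data.Unit using (tt)
open import Data.Empty using (⊥; ⊥-elim)
open import Data.Sum using (_⊎_; inj₁; inj₂)
open import Data.Product using (_,_; proj₁; proj₂; map₁)
open import Data.List using (List; []; _∷_; _∷ʳ_; [_])
import Data.List.NonEmpty as List⁺
open import Data.List.Relation.Unary.All as All using (All; []; _∷_)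
import Data.List.Relation.Unary.All.Properties as All
open import Data.List.Relation.Unary.Linked as Linked using (Linked; []; [-]; _∷_)
open import Data.List.Relation.Unary.Linked.Properties using (Linked⇒All)
open import Data.Nat.ListAction using (sum)
open import Data.Nat.ListAction.Properties using (sum-++)
open import Data.Nat.Induction using (<-rec)
open import Data.Fin using (zero)
open import Data.Fin.Properties using (+↔⊎)
open import Data.Sum.Function.Propositional using (_⊎-↔_)
open import Function using (_∘_)
open import Function.Bundles using (mk↔ₛ′)
open import Function.Properties.Inverse using (↔-trans; ↔-sym)
open import Relation.Nullary using (¬_; yes; no)
open import Relation.Nullary.Negation using (contradiction)
open import Relation.Unary using (Irrelevant)
open import Relation.Binary.PropositionalEquality
  using (refl; sym; trans; cong; cong₂; subst; _≗_; module ≡-Reasoning)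

m≤o∸n⇒n≤o∸m : ∀ {m n o} → n ≤ o → m ≤ o ∸ n → n ≤ o ∸ m
m≤o∸n⇒n≤o∸m {m} {n} {o} n≤o m≤o∸n =
  ℕₚ.m+n≤o⇒m≤o∸n n (subst (_≤ o) (ℕₚ.+-comm m n) (ℕₚ.m≤o∸n⇒m+n≤o m n≤o m≤o∸n))

if-T : ∀ {A : Set} b {x y : A} → T b → (if b then x else y) ≡ x
if-T true _ = refl

if-¬T : ∀ {A : Set} b {x y : A} → ¬ T b → (if b then x else y) ≡ y
if-¬T false _   = refl
if-¬T true  ¬tt = contradiction tt ¬tt

Σ-≡-irrelevant : ∀ {A : Set} {P : A → Set} → Irrelevant P → ∀ {x y} {p : P x} {q : P y} →
                 x ≡ y → (x , p) ≡ (y , q)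
Σ-≡-irrelevant irr {p = p} {q} refl = cong (_ ,_) (irr p q)

splitLast : ∀ {A : Set} → A → List A → List A × A
splitLast x []       = [] , x
splitLast x (y ∷ ys) = map₁ (x ∷_) (splitLast y ys)

splitLast-∷ʳ : ∀ {A : Set} (x : A) xs → proj₁ (splitLast x xs) ∷ʳ proj₂ (splitLast x xs) ≡ x ∷ xs
splitLast-∷ʳ x []       = refl
splitLast-∷ʳ x (y ∷ ys) = cong (x ∷_) (splitLast-∷ʳ y ys)

splitLast-of-∷ʳ : ∀ {A : Set} (y : A) ys a → splitLast y (ys ∷ʳ a) ≡ (y ∷ ys , a)
splitLast-of-∷ʳ y []        a = refl
splitLast-of-∷ʳ y (y′ ∷ ys) a = cong (map₁ (y ∷_)) (splitLast-of-∷ʳ y′ ys a)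

All-splitLast : ∀ {A : Set} {P : A → Set} {x xs} → All P (x ∷ xs) →
                All P (proj₁ (splitLast x xs)) × P (proj₂ (splitLast x xs))
All-splitLast {x = x} {xs} all = All.∷ʳ⁻ (subst (All _) (sym (splitLast-∷ʳ x xs)) all)

module Series where
  open import Data.Integer using (_+_; _*_; -_; _-_)
  open import Data.Integer.Tactic.RingSolver using (solve-∀)
  open import Algebra.Properties.AbelianGroup ℤₚ.+-0-abelianGroup using (inverseˡ-unique)
  open ≡-Reasoning

  Σ≤-cong : ∀ n {f g : ℕ → ℤ} → (∀ k → k ≤ n → f k ≡ g k) → Σ≤ n f ≡ Σ≤ n g
  Σ≤-cong zero    f≡g = f≡g 0 z≤n
  Σ≤-cong (suc n) f≡g =
    cong₂ _+_ (Σ≤-cong n (λ k k≤n → f≡g k (ℕₚ.m≤n⇒m≤1+n k≤n))) (f≡g (suc n) ℕₚ.≤-refl)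

  Σ≤-zero : ∀ n {f : ℕ → ℤ} → (∀ k → k ≤ n → f k ≡ + 0) → Σ≤ n f ≡ + 0
  Σ≤-zero zero    f≡0 = f≡0 0 z≤n
  Σ≤-zero (suc n) f≡0 =
    cong₂ _+_ (Σ≤-zero n (λ k k≤n → f≡0 k (ℕₚ.m≤n⇒m≤1+n k≤n))) (f≡0 (suc n) ℕₚ.≤-refl)

  Σ≤-head : ∀ n (f : ℕ → ℤ) → Σ≤ (suc n) f ≡ f 0 + Σ≤ n (f ∘ suc)
  Σ≤-head zero    f = refl
  Σ≤-head (suc n) f = begin
    Σ≤ (suc n) f + f (suc (suc n))           ≡⟨ cong (_+ f (suc (suc n))) (Σ≤-head n f) ⟩
    (f 0 + Σ≤ n (f ∘ suc)) + f (suc (suc n)) ≡⟨ ℤₚ.+-assoc (f 0) _ _ ⟩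
    f 0 + Σ≤ (suc n) (f ∘ suc)               ∎

  Σ≤-reverse : ∀ n (f : ℕ → ℤ) → Σ≤ n f ≡ Σ≤ n (λ k → f (n ∸ k))
  Σ≤-reverse zero    f = refl
  Σ≤-reverse (suc n) f = begin
    Σ≤ n f + f (suc n)                 ≡⟨ ℤₚ.+-comm (Σ≤ n f) (f (suc n)) ⟩
    f (suc n) + Σ≤ n f                 ≡⟨ cong (λ s → f (suc n) + s) (Σ≤-reverse n f) ⟩
    f (suc n) + Σ≤ n (λ k → f (n ∸ k)) ≡⟨ Σ≤-head n (λ k → f (suc n ∸ k)) ⟨
    Σ≤ (suc n) (λ k → f (suc n ∸ k))   ∎

  Σ≤-sub : ∀ n (f g : ℕ → ℤ) → Σ≤ n (λ k → f k - g k) ≡ Σ≤ n f - Σ≤ n g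
  Σ≤-sub zero    f g = refl
  Σ≤-sub (suc n) f g = begin
    Σ≤ n (λ k → f k - g k) + (f (suc n) - g (suc n))
      ≡⟨ cong (_+ (f (suc n) - g (suc n))) (Σ≤-sub n f g) ⟩
    (Σ≤ n f - Σ≤ n g) + (f (suc n) - g (suc n))
      ≡⟨ interchange (Σ≤ n f) (Σ≤ n g) (f (suc n)) (g (suc n)) ⟩
    (Σ≤ n f + f (suc n)) - (Σ≤ n g + g (suc n)) ∎
    where
    interchange : ∀ a b c d → (a - b) + (c - d) ≡ (a + c) - (b + d)
    interchange = solve-∀

  Σ≤-truncate : ∀ m n (f : ℕ → ℤ) → m ≤ n → (∀ k → m < k → k ≤ n → f k ≡ + 0) →
                Σ≤ n f ≡ Σ≤ m f
  Σ≤-truncate m zero    f z≤n tail≡0 = refl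
  Σ≤-truncate m (suc n) f m≤1+n tail≡0 with ℕₚ.m≤n⇒m<n∨m≡n m≤1+n
  ... | inj₂ refl      = refl
  ... | inj₁ (s≤s m≤n) = begin
    Σ≤ n f + f (suc n)
      ≡⟨ cong₂ _+_ (Σ≤-truncate m n f m≤n tail≡0′) (tail≡0 (suc n) (s≤s m≤n) ℕₚ.≤-refl) ⟩
    Σ≤ m f + + 0       ≡⟨ ℤₚ.+-identityʳ _ ⟩
    Σ≤ m f             ∎
    where
    tail≡0′ : ∀ k → m < k → k ≤ n → f k ≡ + 0
    tail≡0′ k m<k k≤n = tail≡0 k m<k (ℕₚ.m≤n⇒m≤1+n k≤n)

  Σ1≤-cong : ∀ n {f g : ℕ → ℤ} → (∀ k → 1 ≤ k → k ≤ n → f k ≡ g k) → Σ1≤ n f ≡ Σ1≤ n g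
  Σ1≤-cong zero    f≡g = refl
  Σ1≤-cong (suc n) f≡g =
    cong₂ _+_ (Σ1≤-cong n (λ k 1≤k k≤n → f≡g k 1≤k (ℕₚ.m≤n⇒m≤1+n k≤n)))
              (f≡g (suc n) (s≤s z≤n) ℕₚ.≤-refl)

  Σ≤≡head+Σ1≤ : ∀ n (f : ℕ → ℤ) → Σ≤ n f ≡ f 0 + Σ1≤ n f
  Σ≤≡head+Σ1≤ zero    f = sym (ℤₚ.+-identityʳ _)
  Σ≤≡head+Σ1≤ (suc n) f = trans (cong (_+ f (suc n)) (Σ≤≡head+Σ1≤ n f)) (ℤₚ.+-assoc (f 0) _ _)

  ⊛-congˡ : ∀ {f f′} g → f ≗ f′ → (f ⊛ g) ≗ (f′ ⊛ g)
  ⊛-congˡ g f≗f′ n = Σ≤-cong n (λ k _ → cong (_* g (n ∸ k)) (f≗f′ k))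

  ⊛-congʳ : ∀ f {g g′} → g ≗ g′ → (f ⊛ g) ≗ (f ⊛ g′)
  ⊛-congʳ f g≗g′ n = Σ≤-cong n (λ k _ → cong (f k *_) (g≗g′ (n ∸ k)))

  ⊛-comm : ∀ f g → (f ⊛ g) ≗ (g ⊛ f)
  ⊛-comm f g n = begin
    Σ≤ n (λ k → f k * g (n ∸ k))             ≡⟨ Σ≤-reverse n _ ⟩
    Σ≤ n (λ k → f (n ∸ k) * g (n ∸ (n ∸ k))) ≡⟨ Σ≤-cong n swap ⟩
    Σ≤ n (λ k → g k * f (n ∸ k))             ∎
    where
    swap : ∀ k → k ≤ n → f (n ∸ k) * g (n ∸ (n ∸ k)) ≡ g k * f (n ∸ k)
    swap k k≤n = trans (cong (λ j → f (n ∸ k) * g j) (ℕₚ.m∸[m∸n]≡n k≤n)) (ℤₚ.*-comm (f (n ∸ k)) (g k))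

  ⊛-identityʳ : ∀ f → (f ⊛ oneS) ≗ f
  ⊛-identityʳ f zero    = ℤₚ.*-identityʳ (f 0)
  ⊛-identityʳ f (suc n) = begin
    Σ≤ n (λ k → f k * oneS (suc n ∸ k)) + f (suc n) * oneS (suc n ∸ suc n)
      ≡⟨ cong₂ _+_ (Σ≤-zero n off-diagonal) (cong (λ j → f (suc n) * oneS j) (ℕₚ.n∸n≡0 n)) ⟩
    + 0 + f (suc n) * + 1 ≡⟨ ℤₚ.+-identityˡ _ ⟩
    f (suc n) * + 1       ≡⟨ ℤₚ.*-identityʳ (f (suc n)) ⟩
    f (suc n)             ∎
    where
    off-diagonal : ∀ k → k ≤ n → f k * oneS (suc n ∸ k) ≡ + 0
    off-diagonal k k≤n = trans (cong (λ j → f k * oneS j) (ℕₚ.+-∸-assoc 1 k≤n)) (ℤₚ.*-zeroʳ (f k))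

  ⊛-identityˡ : ∀ f → (oneS ⊛ f) ≗ f
  ⊛-identityˡ f n = trans (⊛-comm oneS f n) (⊛-identityʳ f n)

  ⊛-distribˡ-⊖ : ∀ f g h → (f ⊛ (g ⊖ h)) ≗ ((f ⊛ g) ⊖ (f ⊛ h))
  ⊛-distribˡ-⊖ f g h n =
    trans (Σ≤-cong n (λ k _ → a*[b-c]≡a*b-a*c (f k) (g (n ∸ k)) (h (n ∸ k)))) (Σ≤-sub n _ _)
    where
    a*[b-c]≡a*b-a*c : ∀ a b c → a * (b - c) ≡ a * b - a * c
    a*[b-c]≡a*b-a*c = solve-∀

  shift : ℕ → FPS → FPS
  shift t f n with t ≤? n
  ... | yes _ = f (n ∸ t)
  ... | no  _ = + 0

  shift-≤ : ∀ t f {n} → t ≤ n → shift t f n ≡ f (n ∸ t)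
  shift-≤ t f {n} t≤n with t ≤? n
  ... | yes _   = refl
  ... | no  t≰n = contradiction t≤n t≰n

  shift-≰ : ∀ t f {n} → ¬ t ≤ n → shift t f n ≡ + 0
  shift-≰ t f {n} t≰n with t ≤? n
  ... | yes t≤n = contradiction t≤n t≰n
  ... | no  _   = refl

  shift-cong : ∀ t {f g} → f ≗ g → shift t f ≗ shift t g
  shift-cong t f≗g n with t ≤? n
  ... | yes _ = f≗g (n ∸ t)
  ... | no  _ = refl

  ⊛-shiftʳ : ∀ t f g → (f ⊛ shift t g) ≗ shift t (f ⊛ g)
  ⊛-shiftʳ t f g n with t ≤? n
  ... | no t≰n = Σ≤-zero n (λ k k≤n →
          trans (cong (f k *_) (shift-≰ t g (λ t≤n∸k → t≰n (ℕₚ.≤-trans t≤n∸k (ℕₚ.m∸n≤m n k)))))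
                (ℤₚ.*-zeroʳ (f k)))
  ... | yes t≤n = begin
    Σ≤ n (λ k → f k * shift t g (n ∸ k))       ≡⟨ Σ≤-truncate (n ∸ t) n _ (ℕₚ.m∸n≤m n t) vanishes ⟩
    Σ≤ (n ∸ t) (λ k → f k * shift t g (n ∸ k)) ≡⟨ Σ≤-cong (n ∸ t) shifted ⟩
    Σ≤ (n ∸ t) (λ k → f k * g (n ∸ t ∸ k))     ∎
    where
    vanishes : ∀ k → n ∸ t < k → k ≤ n → f k * shift t g (n ∸ k) ≡ + 0
    vanishes k n∸t<k k≤n = trans (cong (f k *_) (shift-≰ t g t≰n∸k)) (ℤₚ.*-zeroʳ (f k))
      where
      t≰n∸k : ¬ t ≤ n ∸ k
      t≰n∸k t≤n∸k = ℕₚ.<⇒≱ n∸t<k (m≤o∸n⇒n≤o∸m k≤n t≤n∸k)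
    shifted : ∀ k → k ≤ n ∸ t → f k * shift t g (n ∸ k) ≡ f k * g (n ∸ t ∸ k)
    shifted k k≤n∸t = cong (f k *_) (trans (shift-≤ t g (m≤o∸n⇒n≤o∸m t≤n k≤n∸t)) (cong g ∸-swap))
      where
      ∸-swap : n ∸ k ∸ t ≡ n ∸ t ∸ k
      ∸-swap = trans (ℕₚ.∸-+-assoc n k t) (trans (cong (n ∸_) (ℕₚ.+-comm k t)) (sym (ℕₚ.∸-+-assoc n t k)))

  ⊛-shiftˡ : ∀ t f g → (shift t f ⊛ g) ≗ shift t (f ⊛ g)
  ⊛-shiftˡ t f g n =
    trans (⊛-comm (shift t f) g n) (trans (⊛-shiftʳ t g f n) (shift-cong t (⊛-comm g f) n))

  qPow≗shift-oneS : ∀ t → qPow t ≗ shift t oneS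
  qPow≗shift-oneS t n with t ℕ.≟ n
  ... | yes refl = begin
    qPow t t           ≡⟨ if-T (t ℕ.≡ᵇ t) (ℕₚ.≡⇒≡ᵇ t t refl) ⟩
    + 1                ≡⟨ cong oneS (ℕₚ.n∸n≡0 t) ⟨
    oneS (t ∸ t)       ≡⟨ shift-≤ t oneS ℕₚ.≤-refl ⟨
    shift t oneS t     ∎
  ... | no t≢n = trans (if-¬T (t ℕ.≡ᵇ n) (t≢n ∘ ℕₚ.≡ᵇ⇒≡ t n)) (sym shift-oneS≡0)
    where
    shift-oneS≡0 : shift t oneS n ≡ + 0
    shift-oneS≡0 with t ≤? n
    ... | no  _   = refl
    ... | yes t≤n with n ∸ t in n∸t≡
    ...   | zero  = contradiction (ℕₚ.≤-antisym t≤n (ℕₚ.m∸n≡0⇒m≤n n∸t≡)) t≢n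
    ...   | suc _ = refl

  ⟨1-q^_⟩_ : ℕ → FPS → FPS
  ⟨1-q^ t ⟩ f = f ⊖ shift t f

  ⟨1-q^⟩-cong : ∀ t {f g} → f ≗ g → ⟨1-q^ t ⟩ f ≗ ⟨1-q^ t ⟩ g
  ⟨1-q^⟩-cong t f≗g n = cong₂ _-_ (f≗g n) (shift-cong t f≗g n)

  1-q^≗⟨1-q^⟩oneS : ∀ t → (oneS ⊖ qPow t) ≗ ⟨1-q^ t ⟩ oneS
  1-q^≗⟨1-q^⟩oneS t n = cong (λ s → oneS n - s) (qPow≗shift-oneS t n)

  ⊛-⟨1-q^⟩ʳ : ∀ t f g → (f ⊛ (⟨1-q^ t ⟩ g)) ≗ ⟨1-q^ t ⟩ (f ⊛ g)
  ⊛-⟨1-q^⟩ʳ t f g n =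
    trans (⊛-distribˡ-⊖ f g (shift t g) n) (cong (λ s → (f ⊛ g) n - s) (⊛-shiftʳ t f g n))

  ⊛-⟨1-q^⟩ˡ : ∀ t f g → ((⟨1-q^ t ⟩ f) ⊛ g) ≗ ⟨1-q^ t ⟩ (f ⊛ g)
  ⊛-⟨1-q^⟩ˡ t f g n =
    trans (⊛-comm (⟨1-q^ t ⟩ f) g n) (trans (⊛-⟨1-q^⟩ʳ t g f n) (⟨1-q^⟩-cong t (⊛-comm g f) n))

  ⟨1-q^⟩-unfold : ∀ t f g → ⟨1-q^ t ⟩ f ≗ g → ∀ n → f n ≡ g n + shift t f n
  ⟨1-q^⟩-unfold t f g eq n = begin
    f n                               ≡⟨ a≡a-b+b (f n) (shift t f n) ⟩
    (f n - shift t f n) + shift t f n ≡⟨ cong (_+ shift t f n) (eq n) ⟩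
    g n + shift t f n                 ∎
    where
    a≡a-b+b : ∀ a b → a ≡ (a - b) + b
    a≡a-b+b = solve-∀

  invAux-stable : ∀ f n j → j ≤ n → invAux f n j ≡ inv f j
  invAux-stable f zero    .zero z≤n   = refl
  invAux-stable f (suc n) j     j≤1+n with ℕₚ.m≤n⇒m<n∨m≡n j≤1+n
  ... | inj₁ (s≤s j≤n) = trans (if-T (j ℕ.≤ᵇ n) (ℕₚ.≤⇒≤ᵇ j≤n)) (invAux-stable f n j j≤n)
  ... | inj₂ refl      = refl

  inv-suc : ∀ f m → inv f (suc m) ≡ - Σ1≤ (suc m) (λ k → f k * inv f (suc m ∸ k))
  inv-suc f m =
    trans (if-¬T (suc m ℕ.≤ᵇ m) (ℕₚ.<-irrefl refl ∘ ℕₚ.≤ᵇ⇒≤ (suc m) m))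
          (cong -_ (Σ1≤-cong (suc m) λ k 1≤k _ →
             cong (f k *_) (invAux-stable f m (suc m ∸ k) (ℕₚ.∸-monoʳ-≤ (suc m) 1≤k))))

  ⊛-suc-monic : ∀ f g m → f 0 ≡ + 1 →
                (f ⊛ g) (suc m) ≡ g (suc m) + Σ1≤ (suc m) (λ k → f k * g (suc m ∸ k))
  ⊛-suc-monic f g m f0≡1 = begin
    (f ⊛ g) (suc m)              ≡⟨ Σ≤≡head+Σ1≤ (suc m) (λ k → f k * g (suc m ∸ k)) ⟩
    f 0 * g (suc m) + rest       ≡⟨ cong (λ c → c * g (suc m) + rest) f0≡1 ⟩
    + 1 * g (suc m) + rest       ≡⟨ cong (_+ rest) (ℤₚ.*-identityˡ (g (suc m))) ⟩
    g (suc m) + rest             ∎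
    where rest = Σ1≤ (suc m) (λ k → f k * g (suc m ∸ k))

  ⊛-inv : ∀ f → f 0 ≡ + 1 → (f ⊛ inv f) ≗ oneS
  ⊛-inv f f0≡1 zero    = cong (ℤ._* + 1) f0≡1
  ⊛-inv f f0≡1 (suc m) = begin
    (f ⊛ inv f) (suc m) ≡⟨ ⊛-suc-monic f (inv f) m f0≡1 ⟩
    inv f (suc m) + S   ≡⟨ cong (_+ S) (inv-suc f m) ⟩
    - S + S             ≡⟨ ℤₚ.+-inverseˡ S ⟩
    + 0                 ∎
    where S = Σ1≤ (suc m) (λ k → f k * inv f (suc m ∸ k))

  -- Course-of-values induction: g j is determined by the g i with i < j.
  inv-unique : ∀ f g → f 0 ≡ + 1 → (f ⊛ g) ≗ oneS → g ≗ inv f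
  inv-unique f g f0≡1 fg≗1 n = agree n n ℕₚ.≤-refl
    where
    agree : ∀ m j → j ≤ m → g j ≡ inv f j
    agree m zero _ = begin
      g 0       ≡⟨ ℤₚ.*-identityˡ (g 0) ⟨
      + 1 * g 0 ≡⟨ cong (ℤ._* g 0) f0≡1 ⟨
      f 0 * g 0 ≡⟨ fg≗1 0 ⟩
      + 1       ∎
    agree (suc m) (suc j) (s≤s j≤m) = begin
      g (suc j)
        ≡⟨ inverseˡ-unique _ _ (trans (sym (⊛-suc-monic f g j f0≡1)) (fg≗1 (suc j))) ⟩
      - Σ1≤ (suc j) (λ k → f k * g (suc j ∸ k))     ≡⟨ cong -_ (Σ1≤-cong (suc j) earlier) ⟩
      - Σ1≤ (suc j) (λ k → f k * inv f (suc j ∸ k)) ≡⟨ inv-suc f j ⟨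
      inv f (suc j)                                 ∎
      where
      earlier : ∀ k → 1 ≤ k → k ≤ suc j → f k * g (suc j ∸ k) ≡ f k * inv f (suc j ∸ k)
      earlier k 1≤k _ = cong (f k *_) (agree m (suc j ∸ k) (ℕₚ.≤-trans (ℕₚ.∸-monoʳ-≤ (suc j) 1≤k) j≤m))

  ∏[1-qⁱ] : ℕ → FPS
  ∏[1-qⁱ] t = ∏1≤ t (λ i → oneS ⊖ qPow i)

  partsAtMostGF : ℕ → FPS
  partsAtMostGF t = inv (∏[1-qⁱ] t)

  ∏[1-qⁱ]-constant : ∀ t → ∏[1-qⁱ] t 0 ≡ + 1
  ∏[1-qⁱ]-constant zero    = refl
  ∏[1-qⁱ]-constant (suc t) = cong (ℤ._* + 1) (∏[1-qⁱ]-constant t)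

  partsAtMostGF-zero : partsAtMostGF 0 ≗ oneS
  partsAtMostGF-zero n = sym (inv-unique oneS oneS refl (⊛-identityʳ oneS) n)

  partsAtMostGF-suc : ∀ t n →
    partsAtMostGF (suc t) n ≡ partsAtMostGF t n + shift (suc t) (partsAtMostGF (suc t)) n
  partsAtMostGF-suc t = ⟨1-q^⟩-unfold (suc t) I′ I
    (inv-unique (∏[1-qⁱ] t) (⟨1-q^ suc t ⟩ I′) (∏[1-qⁱ]-constant t) λ n → begin
      (∏[1-qⁱ] t ⊛ (⟨1-q^ suc t ⟩ I′)) n   ≡⟨ ⊛-⟨1-q^⟩ʳ (suc t) (∏[1-qⁱ] t) I′ n ⟩
      (⟨1-q^ suc t ⟩ (∏[1-qⁱ] t ⊛ I′)) n   ≡⟨ ⊛-⟨1-q^⟩ˡ (suc t) (∏[1-qⁱ] t) I′ n ⟨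
      ((⟨1-q^ suc t ⟩ ∏[1-qⁱ] t) ⊛ I′) n   ≡⟨ ⊛-congˡ I′ ∏-step n ⟩
      (∏[1-qⁱ] (suc t) ⊛ I′) n             ≡⟨ ⊛-inv (∏[1-qⁱ] (suc t)) (∏[1-qⁱ]-constant (suc t)) n ⟩
      oneS n                               ∎)
    where
    I = partsAtMostGF t
    I′ = partsAtMostGF (suc t)
    ∏-step : (⟨1-q^ suc t ⟩ ∏[1-qⁱ] t) ≗ ∏[1-qⁱ] (suc t)
    ∏-step n = sym (begin
      (∏[1-qⁱ] t ⊛ (oneS ⊖ qPow (suc t))) n  ≡⟨ ⊛-congʳ (∏[1-qⁱ] t) (1-q^≗⟨1-q^⟩oneS (suc t)) n ⟩
      (∏[1-qⁱ] t ⊛ (⟨1-q^ suc t ⟩ oneS)) n   ≡⟨ ⊛-⟨1-q^⟩ʳ (suc t) (∏[1-qⁱ] t) oneS n ⟩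
      (⟨1-q^ suc t ⟩ (∏[1-qⁱ] t ⊛ oneS)) n   ≡⟨ ⟨1-q^⟩-cong (suc t) (⊛-identityʳ (∏[1-qⁱ] t)) n ⟩
      (⟨1-q^ suc t ⟩ ∏[1-qⁱ] t) n            ∎)

  1-q^-constant : ∀ t → 1 ≤ t → (oneS ⊖ qPow t) 0 ≡ + 1
  1-q^-constant (suc t) _ = refl

  RHS-unfold : ∀ t → 1 ≤ t → ∀ n → RHS t n ≡ (partsAtMostGF t n - oneS n) + shift t (RHS t) n
  RHS-unfold t 1≤t = ⟨1-q^⟩-unfold t (RHS t) (partsAtMostGF t ⊖ oneS) λ n → begin
    (⟨1-q^ t ⟩ RHS t) n                          ≡⟨ ⊛-⟨1-q^⟩ʳ t (partsAtMostGF t ⊖ oneS) G n ⟨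
    ((partsAtMostGF t ⊖ oneS) ⊛ (⟨1-q^ t ⟩ G)) n ≡⟨ ⊛-congʳ (partsAtMostGF t ⊖ oneS) ⟨1-q^⟩G≗1 n ⟩
    ((partsAtMostGF t ⊖ oneS) ⊛ oneS) n          ≡⟨ ⊛-identityʳ (partsAtMostGF t ⊖ oneS) n ⟩
    (partsAtMostGF t ⊖ oneS) n                   ∎
    where
    G = inv (oneS ⊖ qPow t)
    ⟨1-q^⟩G≗1 : (⟨1-q^ t ⟩ G) ≗ oneS
    ⟨1-q^⟩G≗1 n = begin
      (⟨1-q^ t ⟩ G) n                ≡⟨ ⟨1-q^⟩-cong t (⊛-identityˡ G) n ⟨
      (⟨1-q^ t ⟩ (oneS ⊛ G)) n       ≡⟨ ⊛-⟨1-q^⟩ˡ t oneS G n ⟨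
      ((⟨1-q^ t ⟩ oneS) ⊛ G) n       ≡⟨ ⊛-congˡ G (1-q^≗⟨1-q^⟩oneS t) n ⟨
      ((oneS ⊖ qPow t) ⊛ G) n        ≡⟨ ⊛-inv (oneS ⊖ qPow t) (1-q^-constant t 1≤t) n ⟩
      oneS n                         ∎

  RHS-zero : ∀ t → 1 ≤ t → RHS t 0 ≡ + 0
  RHS-zero t 1≤t = trans (RHS-unfold t 1≤t 0)
    (trans (ℤₚ.+-identityˡ _) (shift-≰ t (RHS t) (ℕₚ.<⇒≱ 1≤t)))

  RHS-suc : ∀ t → 1 ≤ t → ∀ n → RHS t (suc n) ≡ partsAtMostGF t (suc n) + shift t (RHS t) (suc n)
  RHS-suc t 1≤t n = trans (RHS-unfold t 1≤t (suc n))
    (cong (_+ shift t (RHS t) (suc n)) (ℤₚ.+-identityʳ (partsAtMostGF t (suc n))))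

module Counting where
  open import Data.Integer using (_+_)
  open Series using (shift)

  Counted : Set → ℤ → Set
  Counted X c = Σ ℕ λ k → (Fin k ↔ X) × (+ k ≡ c)

  Counted-↔ : ∀ {X Y c} → X ↔ Y → Counted X c → Counted Y c
  Counted-↔ X↔Y (k , Fin↔X , k≡c) = k , ↔-trans Fin↔X X↔Y , k≡c

  Counted-⊎ : ∀ {X Y a b} → Counted X a → Counted Y b → Counted (X ⊎ Y) (a + b)
  Counted-⊎ (k , Fin↔X , k≡a) (l , Fin↔Y , l≡b) =
    k ℕ.+ l , ↔-trans +↔⊎ (Fin↔X ⊎-↔ Fin↔Y) , trans (ℤₚ.pos-+ k l) (cong₂ _+_ k≡a l≡b)

  Counted-empty : ∀ {X} → ¬ X → Counted X (+ 0)
  Counted-empty ¬x = 0 , mk↔ₛ′ (λ ()) (⊥-elim ∘ ¬x) (⊥-elim ∘ ¬x) (λ ()) , refl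

  Counted-singleton : ∀ {X} (x : X) → (∀ y → y ≡ x) → Counted X (+ 1)
  Counted-singleton x unique = 1 , mk↔ₛ′ (λ _ → x) (λ _ → zero) (sym ∘ unique) (λ { zero → refl }) , refl

  Counted-shift : ∀ t f n (X : ℕ → Set) → (t ≤ n → Counted (X (n ∸ t)) (f (n ∸ t))) →
                  Counted (Σ (t ≤ n) λ _ → X (n ∸ t)) (shift t f n)
  Counted-shift t f n X count with t ≤? n
  ... | yes t≤n = Counted-↔ (mk↔ₛ′ (t≤n ,_) proj₂ (λ (t≤n′ , x) → cong (_, x) (ℕₚ.≤-irrelevant t≤n t≤n′)) (λ _ → refl))
                            (count t≤n)
  ... | no  t≰n = Counted-empty (t≰n ∘ proj₁)

module PartitionLists where
  open import Data.Nat using (_+_)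
  open Series using (shift; partsAtMostGF; partsAtMostGF-zero; partsAtMostGF-suc; RHS-zero; RHS-suc)
  open Counting
  open ≡-Reasoning

  sum-∷ʳ : ∀ ys a → sum (ys ∷ʳ a) ≡ sum ys + a
  sum-∷ʳ ys a = trans (sum-++ ys [ a ]) (cong (λ m → sum ys + m) (ℕₚ.+-identityʳ a))

  decreasing⇒≤head : ∀ {h ys} → Linked _≥_ (h ∷ ys) → All (_≤ h) ys
  decreasing⇒≤head [-]         = []
  decreasing⇒≤head (h≥y ∷ dec) = Linked⇒All (λ x≥y y≥z → ℕₚ.≤-trans y≥z x≥y) h≥y dec

  decreasing⇒All≤ : ∀ {t h ys} → Linked _≥_ (h ∷ ys) → h ≤ t → All (_≤ t) (h ∷ ys)
  decreasing⇒All≤ dec h≤t = h≤t ∷ All.map (λ y≤h → ℕₚ.≤-trans y≤h h≤t) (decreasing⇒≤head dec)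

  ≤head⇒decreasing : ∀ {h ys} → All (_≤ h) ys → Linked _≥_ ys → Linked _≥_ (h ∷ ys)
  ≤head⇒decreasing []        _   = [-]
  ≤head⇒decreasing (y≤h ∷ _) dec = y≤h ∷ dec

  decreasing-∷ʳ : ∀ {a} ys → Linked _≥_ ys → All (a ≤_) ys → Linked _≥_ (ys ∷ʳ a)
  decreasing-∷ʳ []            _             _           = [-]
  decreasing-∷ʳ (y ∷ [])      _             (a≤y ∷ [])  = a≤y ∷ [-]
  decreasing-∷ʳ (y ∷ y′ ∷ ys) (y≥y′ ∷ dec) (_ ∷ a≤ys) = y≥y′ ∷ decreasing-∷ʳ (y′ ∷ ys) dec a≤ys

  decreasing-∷ʳ⁻ : ∀ {a} ys → Linked _≥_ (ys ∷ʳ a) → Linked _≥_ ys × All (a ≤_) ys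
  decreasing-∷ʳ⁻ []            _             = [] , []
  decreasing-∷ʳ⁻ (y ∷ [])      (a≤y ∷ [-])  = [-] , a≤y ∷ []
  decreasing-∷ʳ⁻ (y ∷ y′ ∷ ys) (y≥y′ ∷ dec) with decreasing-∷ʳ⁻ (y′ ∷ ys) dec
  ... | dec′ , a≤y′ ∷ a≤ys = y≥y′ ∷ dec′ , ℕₚ.≤-trans a≤y′ y≥y′ ∷ a≤y′ ∷ a≤ys

  IsPartition : ℕ → List ℕ → Set
  IsPartition n xs = All (1 ≤_) xs × Linked _≥_ xs × sum xs ≡ n

  IsPartition-irrelevant : ∀ {n} → Irrelevant (IsPartition n)
  IsPartition-irrelevant (pos , dec , s) (pos′ , dec′ , s′) =
    cong₂ _,_ (All.irrelevant ℕₚ.≤-irrelevant pos pos′)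
              (cong₂ _,_ (Linked.irrelevant ℕₚ.≤-irrelevant dec dec′) (ℕₚ.≡-irrelevant s s′))

  -- Includes the empty partition of 0, as the coefficients of 1/((1-q)⋯(1-q^t)) require.
  PartsAtMost : ℕ → ℕ → Set
  PartsAtMost t n = Σ (List ℕ) λ xs → IsPartition n xs × All (_≤ t) xs

  PartsAtMost-irrelevant : ∀ {t n} → Irrelevant (λ xs → IsPartition n xs × All (_≤ t) xs)
  PartsAtMost-irrelevant (isP , xs≤t) (isP′ , xs≤t′) =
    cong₂ _,_ (IsPartition-irrelevant isP isP′) (All.irrelevant ℕₚ.≤-irrelevant xs≤t xs≤t′)

  count-PartsAtMost-zero : ∀ n → Counted (PartsAtMost 0 n) (oneS n)
  count-PartsAtMost-zero zero = Counted-singleton ([] , ([] , [] , refl) , []) only-empty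
    where
    only-empty : ∀ p → p ≡ ([] , ([] , [] , refl) , [])
    only-empty ([] , _)                       = Σ-≡-irrelevant PartsAtMost-irrelevant refl
    only-empty (_ ∷ _ , (s≤s _ ∷ _ , _) , () ∷ _)
  count-PartsAtMost-zero (suc n) = Counted-empty no-parts
    where
    no-parts : ¬ PartsAtMost 0 (suc n)
    no-parts ([] , (_ , _ , ()) , _)
    no-parts (_ ∷ _ , (s≤s _ ∷ _ , _) , () ∷ _)

  -- Remove the largest part if it equals t + 1.
  PartsAtMost-suc↔ : ∀ t n → PartsAtMost (suc t) n ↔
                     (PartsAtMost t n ⊎ Σ (suc t ≤ n) λ _ → PartsAtMost (suc t) (n ∸ suc t))
  PartsAtMost-suc↔ t n = mk↔ₛ′ to from to∘from from∘to
    where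
    to : PartsAtMost (suc t) n → PartsAtMost t n ⊎ Σ (suc t ≤ n) λ _ → PartsAtMost (suc t) (n ∸ suc t)
    to ([] , isP , []) = inj₁ ([] , isP , [])
    to (h ∷ ys , isP@(pos , dec , s) , h≤1+t ∷ ys≤1+t) with h ≤? t
    ... | yes h≤t = inj₁ (h ∷ ys , isP , decreasing⇒All≤ dec h≤t)
    ... | no  h≰t = inj₂ (1+t≤n , ys , (All.tail pos , Linked.tail dec , sum-ys) , ys≤1+t)
      where
      h≡1+t : h ≡ suc t
      h≡1+t = ℕₚ.≤-antisym h≤1+t (ℕₚ.≰⇒> h≰t)
      1+t≤n : suc t ≤ n
      1+t≤n = subst (_≤ n) h≡1+t (subst (h ≤_) s (ℕₚ.m≤m+n h (sum ys)))
      sum-ys : sum ys ≡ n ∸ suc t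
      sum-ys = subst (λ c → sum ys ≡ n ∸ c) h≡1+t (trans (sym (ℕₚ.m+n∸m≡n h (sum ys))) (cong (_∸ h) s))

    from : PartsAtMost t n ⊎ Σ (suc t ≤ n) (λ _ → PartsAtMost (suc t) (n ∸ suc t)) → PartsAtMost (suc t) n
    from (inj₁ (xs , isP , xs≤t)) = xs , isP , All.map ℕₚ.m≤n⇒m≤1+n xs≤t
    from (inj₂ (1+t≤n , ys , (pos , dec , s) , ys≤1+t)) =
      suc t ∷ ys ,
      (s≤s z≤n ∷ pos , ≤head⇒decreasing ys≤1+t dec ,
       trans (cong (λ m → suc t + m) s) (ℕₚ.m+[n∸m]≡n 1+t≤n)) ,
      ℕₚ.≤-refl ∷ ys≤1+t

    from∘to : ∀ x → from (to x) ≡ x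
    from∘to ([] , _ , []) = Σ-≡-irrelevant PartsAtMost-irrelevant refl
    from∘to (h ∷ ys , _ , h≤1+t ∷ _) with h ≤? t
    ... | yes _   = Σ-≡-irrelevant PartsAtMost-irrelevant refl
    ... | no  h≰t = Σ-≡-irrelevant PartsAtMost-irrelevant (cong (_∷ ys) (ℕₚ.≤-antisym (ℕₚ.≰⇒> h≰t) h≤1+t))

    to∘from : ∀ y → to (from y) ≡ y
    to∘from (inj₁ ([] , _ , [])) = cong inj₁ (Σ-≡-irrelevant PartsAtMost-irrelevant refl)
    to∘from (inj₁ (h ∷ _ , _ , h≤t ∷ _)) with h ≤? t
    ... | yes _   = cong inj₁ (Σ-≡-irrelevant PartsAtMost-irrelevant refl)
    ... | no  h≰t = contradiction h≤t h≰t
    to∘from (inj₂ _) with suc t ≤? t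
    ... | yes 1+t≤t = contradiction 1+t≤t (ℕₚ.<-irrefl refl)
    ... | no  _     = cong inj₂ (cong₂ _,_ (ℕₚ.≤-irrelevant _ _) (Σ-≡-irrelevant PartsAtMost-irrelevant refl))

  count-PartsAtMost : ∀ t n → Counted (PartsAtMost t n) (partsAtMostGF t n)
  count-PartsAtMost zero    n = subst (Counted _) (sym (partsAtMostGF-zero n)) (count-PartsAtMost-zero n)
  count-PartsAtMost (suc t) = <-rec (λ n → Counted (PartsAtMost (suc t) n) (partsAtMostGF (suc t) n)) step
    where
    step : ∀ n → (∀ {m} → m < n → Counted (PartsAtMost (suc t) m) (partsAtMostGF (suc t) m)) →
           Counted (PartsAtMost (suc t) n) (partsAtMostGF (suc t) n)
    step n smaller =
      Counted-↔ (↔-sym (PartsAtMost-suc↔ t n))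
        (subst (Counted _) (sym (partsAtMostGF-suc t n))
          (Counted-⊎ (count-PartsAtMost t n)
                     (Counted-shift (suc t) (partsAtMostGF (suc t)) n (PartsAtMost (suc t))
                                    (λ 1+t≤n → smaller (ℕₚ.∸-monoʳ-< (s≤s z≤n) 1+t≤n)))))

  -- Bounded difference t, for a decreasing list headed by its largest part.
  BoundedDiff : ℕ → List ℕ → Set
  BoundedDiff t []       = ⊥
  BoundedDiff t (h ∷ ys) = All (λ y → h ≤ y + t) ys

  BDList : ℕ → ℕ → Set
  BDList t n = Σ (List ℕ) λ xs → IsPartition n xs × BoundedDiff t xs

  BDList-irrelevant : ∀ {t n} → Irrelevant (λ xs → IsPartition n xs × BoundedDiff t xs)
  BDList-irrelevant {x = []}    (_ , ()) _
  BDList-irrelevant {x = _ ∷ _} (isP , bd) (isP′ , bd′) =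
    cong₂ _,_ (IsPartition-irrelevant isP isP′) (All.irrelevant ℕₚ.≤-irrelevant bd bd′)

  BDList-zero-empty : ∀ t → ¬ BDList t 0
  BDList-zero-empty t ([] , _ , ())
  BDList-zero-empty t (_ ∷ _ , (s≤s _ ∷ _ , _ , ()) , _)

  rotate-isPartition : ∀ {t n h ys} → t < h → All (λ y → h ≤ y + t) ys → IsPartition n (h ∷ ys) →
                       IsPartition (n ∸ t) (ys ∷ʳ (h ∸ t))
  rotate-isPartition {t} {n} {h} {ys} t<h bd (pos , dec , s) =
    All.∷ʳ⁺ (All.tail pos) (ℕₚ.m<n⇒0<n∸m t<h) ,
    decreasing-∷ʳ ys (Linked.tail dec) (All.map h∸t≤ bd) ,
    (begin
      sum (ys ∷ʳ (h ∸ t)) ≡⟨ sum-∷ʳ ys (h ∸ t) ⟩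
      sum ys + (h ∸ t)    ≡⟨ ℕₚ.+-∸-assoc (sum ys) (ℕₚ.<⇒≤ t<h) ⟨
      sum ys + h ∸ t      ≡⟨ cong (_∸ t) (ℕₚ.+-comm (sum ys) h) ⟩
      h + sum ys ∸ t      ≡⟨ cong (_∸ t) s ⟩
      n ∸ t               ∎)
    where
    h∸t≤ : ∀ {y} → h ≤ y + t → h ∸ t ≤ y
    h∸t≤ {y} h≤y+t = ℕₚ.m≤n+o⇒m∸n≤o h t (subst (h ≤_) (ℕₚ.+-comm y t) h≤y+t)

  rotate-boundedDiff : ∀ {t h} ys → t ≤ h → All (_≤ h) ys → All (λ y → h ≤ y + t) ys →
                       BoundedDiff t (ys ∷ʳ (h ∸ t))
  rotate-boundedDiff []       _   _         _            = []
  rotate-boundedDiff (y ∷ ys) t≤h (y≤h ∷ _) (_ ∷ h≤ys+t) =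
    All.∷ʳ⁺ (All.map (ℕₚ.≤-trans y≤h) h≤ys+t) (ℕₚ.≤-trans y≤h (ℕₚ.≤-reflexive (sym (ℕₚ.m∸n+n≡m t≤h))))

  unrotate : ℕ → List ℕ → List ℕ
  unrotate t []       = []
  unrotate t (z ∷ zs) = proj₂ (splitLast z zs) + t ∷ proj₁ (splitLast z zs)

  unrotate-∷ʳ : ∀ t ys a → unrotate t (ys ∷ʳ a) ≡ a + t ∷ ys
  unrotate-∷ʳ t []       a = refl
  unrotate-∷ʳ t (y ∷ ys) a = cong (λ (i , l) → l + t ∷ i) (splitLast-of-∷ʳ y ys a)

  unrotate-isPartition : ∀ {t n} ys l → t ≤ n → IsPartition (n ∸ t) (ys ∷ʳ l) → BoundedDiff t (ys ∷ʳ l) →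
                         IsPartition n (l + t ∷ ys)
  unrotate-isPartition {t} {n} ys l t≤n (pos , dec , s) bd =
    ℕₚ.≤-trans (proj₂ (All.∷ʳ⁻ pos)) (ℕₚ.m≤m+n l t) ∷ proj₁ (All.∷ʳ⁻ pos) ,
    ≤head⇒decreasing (≤last+t ys dec bd) (proj₁ (decreasing-∷ʳ⁻ ys dec)) ,
    (begin
      l + t + sum ys   ≡⟨ ℕₚ.+-comm (l + t) (sum ys) ⟩
      sum ys + (l + t) ≡⟨ ℕₚ.+-assoc (sum ys) l t ⟨
      sum ys + l + t   ≡⟨ cong (_+ t) (trans (sym (sum-∷ʳ ys l)) s) ⟩
      n ∸ t + t        ≡⟨ ℕₚ.m∸n+n≡m t≤n ⟩
      n                ∎)
    where
    ≤last+t : ∀ ys → Linked _≥_ (ys ∷ʳ l) → BoundedDiff t (ys ∷ʳ l) → All (_≤ l + t) ys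
    ≤last+t []       _   _  = []
    ≤last+t (a ∷ ys) dec bd =
      decreasing⇒All≤ (proj₁ (decreasing-∷ʳ⁻ (a ∷ ys) dec)) (proj₂ (All.∷ʳ⁻ bd))

  unrotate-boundedDiff : ∀ {t} ys l → Linked _≥_ (ys ∷ʳ l) → BoundedDiff t (l + t ∷ ys)
  unrotate-boundedDiff {t} ys l dec = All.map (ℕₚ.+-monoˡ-≤ t) (proj₂ (decreasing-∷ʳ⁻ ys dec))

  unrotate-BDList : ∀ {t n} zs → t ≤ n → IsPartition (n ∸ t) zs → BoundedDiff t zs →
                    IsPartition n (unrotate t zs) × BoundedDiff t (unrotate t zs)
  unrotate-BDList []       _   _   ()
  unrotate-BDList (z ∷ zs) t≤n isP bd with splitLast z zs | splitLast-∷ʳ z zs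
  ... | ys , l | ys∷ʳl≡z∷zs =
    unrotate-isPartition ys l t≤n isP′ (subst (BoundedDiff _) (sym ys∷ʳl≡z∷zs) bd) ,
    unrotate-boundedDiff ys l (proj₁ (proj₂ isP′))
    where
    isP′ = subst (IsPartition _) (sym ys∷ʳl≡z∷zs) isP

  -- A largest part h > t is replaced by h ∸ t, which becomes the new smallest part.
  BDList-suc↔ : ∀ t n → BDList t (suc n) ↔
                (PartsAtMost t (suc n) ⊎ Σ (t ≤ suc n) λ _ → BDList t (suc n ∸ t))
  BDList-suc↔ t n = mk↔ₛ′ to from to∘from from∘to
    where
    to : BDList t (suc n) → PartsAtMost t (suc n) ⊎ Σ (t ≤ suc n) λ _ → BDList t (suc n ∸ t)
    to ([] , _ , ())
    to (h ∷ ys , isP@(_ , dec , s) , bd) with h ≤? t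
    ... | yes h≤t = inj₁ (h ∷ ys , isP , decreasing⇒All≤ dec h≤t)
    ... | no  h≰t = inj₂ (t≤1+n , ys ∷ʳ (h ∸ t) , rotate-isPartition t<h bd isP ,
                          rotate-boundedDiff ys (ℕₚ.<⇒≤ t<h) (decreasing⇒≤head dec) bd)
      where
      t<h : t < h
      t<h = ℕₚ.≰⇒> h≰t
      t≤1+n : t ≤ suc n
      t≤1+n = ℕₚ.≤-trans (ℕₚ.<⇒≤ t<h) (subst (h ≤_) s (ℕₚ.m≤m+n h (sum ys)))

    from : PartsAtMost t (suc n) ⊎ Σ (t ≤ suc n) (λ _ → BDList t (suc n ∸ t)) → BDList t (suc n)
    from (inj₁ ([] , (_ , _ , ()) , _))
    from (inj₁ (h ∷ ys , isP , h≤t ∷ ys≤t)) =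
      h ∷ ys , isP , All.map (λ {y} _ → ℕₚ.≤-trans h≤t (ℕₚ.m≤n+m t y)) ys≤t
    from (inj₂ (t≤1+n , zs , isP , bd)) = unrotate t zs , unrotate-BDList zs t≤1+n isP bd

    from∘to : ∀ x → from (to x) ≡ x
    from∘to ([] , _ , ())
    from∘to (h ∷ ys , _ , _) with h ≤? t
    ... | yes _   = Σ-≡-irrelevant BDList-irrelevant refl
    ... | no  h≰t = Σ-≡-irrelevant BDList-irrelevant
                      (trans (unrotate-∷ʳ t ys (h ∸ t)) (cong (_∷ ys) (ℕₚ.m∸n+n≡m (ℕₚ.<⇒≤ (ℕₚ.≰⇒> h≰t)))))

    to∘from : ∀ y → to (from y) ≡ y
    to∘from (inj₁ ([] , (_ , _ , ()) , _))
    to∘from (inj₁ (h ∷ _ , _ , h≤t ∷ _)) with h ≤? t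
    ... | yes _   = cong inj₁ (Σ-≡-irrelevant PartsAtMost-irrelevant refl)
    ... | no  h≰t = contradiction h≤t h≰t
    to∘from (inj₂ (_ , [] , _ , ()))
    to∘from (inj₂ (_ , z ∷ zs , (pos , _) , _)) with proj₂ (splitLast z zs) + t ≤? t
    ... | yes l+t≤t = contradiction l+t≤t (ℕₚ.<⇒≱ (ℕₚ.+-monoˡ-≤ t (proj₂ (All-splitLast pos))))
    ... | no  _     =
      cong inj₂ (cong₂ _,_ (ℕₚ.≤-irrelevant _ _) (Σ-≡-irrelevant BDList-irrelevant rotate∘unrotate))
      where
      rotate∘unrotate : proj₁ (splitLast z zs) ∷ʳ (proj₂ (splitLast z zs) + t ∸ t) ≡ z ∷ zs
      rotate∘unrotate = trans (cong (proj₁ (splitLast z zs) ∷ʳ_) (ℕₚ.m+n∸n≡m _ t)) (splitLast-∷ʳ z zs)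

  count-BDList : ∀ t → 1 ≤ t → ∀ n → Counted (BDList t n) (RHS t n)
  count-BDList t 1≤t = <-rec (λ n → Counted (BDList t n) (RHS t n)) step
    where
    step : ∀ n → (∀ {m} → m < n → Counted (BDList t m) (RHS t m)) → Counted (BDList t n) (RHS t n)
    step zero    _       = subst (Counted _) (sym (RHS-zero t 1≤t)) (Counted-empty (BDList-zero-empty t))
    step (suc n) smaller =
      Counted-↔ (↔-sym (BDList-suc↔ t n))
        (subst (Counted _) (sym (RHS-suc t 1≤t n))
          (Counted-⊎ (count-PartsAtMost t (suc n))
                     (Counted-shift t (RHS t) (suc n) (BDList t) (λ t≤1+n → smaller (ℕₚ.∸-monoʳ-< 1≤t t≤1+n)))))

  foldr₁-⊔-decreasing : ∀ h ys → Linked _≥_ (h ∷ ys) → List⁺.foldr₁ _⊔_ (h List⁺.∷ ys) ≡ h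
  foldr₁-⊔-decreasing h []       _           = refl
  foldr₁-⊔-decreasing h (y ∷ ys) (h≥y ∷ dec) =
    trans (cong (h ⊔_) (foldr₁-⊔-decreasing y ys dec)) (ℕₚ.m≥n⇒m⊔n≡m h≥y)

  foldr₁-⊓-lowerBound : ∀ h ys → All (List⁺.foldr₁ _⊓_ (h List⁺.∷ ys) ≤_) (h ∷ ys)
  foldr₁-⊓-lowerBound h []       = ℕₚ.≤-refl ∷ []
  foldr₁-⊓-lowerBound h (y ∷ ys) =
    ℕₚ.m⊓n≤m h _ ∷ All.map (ℕₚ.≤-trans (ℕₚ.m⊓n≤n h _)) (foldr₁-⊓-lowerBound y ys)

  foldr₁-⊓-selective : ∀ {P : ℕ → Set} h ys → All P (h ∷ ys) → P (List⁺.foldr₁ _⊓_ (h List⁺.∷ ys))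
  foldr₁-⊓-selective h []       (ph ∷ [])  = ph
  foldr₁-⊓-selective {P} h (y ∷ ys) (ph ∷ pys) with ℕₚ.⊓-sel h (List⁺.foldr₁ _⊓_ (y List⁺.∷ ys))
  ... | inj₁ h⊓m≡h = subst P (sym h⊓m≡h) ph
  ... | inj₂ h⊓m≡m = subst P (sym h⊓m≡m) (foldr₁-⊓-selective y ys pys)

  BDList↔BDPartition : ∀ t n → BDList t n ↔ BDPartition n t
  BDList↔BDPartition t n = mk↔ₛ′ to from to∘from from∘to
    where
    to : BDList t n → BDPartition n t
    to ([] , _ , ())
    to (h ∷ ys , (pos , dec , s) , bd) = mkBD (mkPartition (h List⁺.∷ ys) pos dec s)
      (subst (λ m → m ∸ min ≤ t) (sym (foldr₁-⊔-decreasing h ys dec))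
        (ℕₚ.m≤n+o⇒m∸n≤o h min (foldr₁-⊓-selective h ys (ℕₚ.m≤m+n h t ∷ bd))))
      where
      min = List⁺.foldr₁ _⊓_ (h List⁺.∷ ys)

    from : BDPartition n t → BDList t n
    from (mkBD (mkPartition (h List⁺.∷ ys) pos dec s) max∸min≤t) =
      h ∷ ys , (pos , dec , s) , All.map (λ min≤y → ℕₚ.≤-trans h≤min+t (ℕₚ.+-monoˡ-≤ t min≤y))
                                         (All.tail (foldr₁-⊓-lowerBound h ys))
      where
      min = List⁺.foldr₁ _⊓_ (h List⁺.∷ ys)
      h≤min+t : h ≤ min + t
      h≤min+t = ℕₚ.≤-trans (ℕₚ.m≤n+m∸n h min)
                  (ℕₚ.+-monoʳ-≤ min (subst (λ m → m ∸ min ≤ t) (foldr₁-⊔-decreasing h ys dec) max∸min≤t))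

    from∘to : ∀ x → from (to x) ≡ x
    from∘to ([] , _ , ())
    from∘to (_ ∷ _ , _) = Σ-≡-irrelevant BDList-irrelevant refl

    to∘from : ∀ y → to (from y) ≡ y
    to∘from (mkBD (mkPartition (_ List⁺.∷ _) _ _ _) _) = cong (mkBD _) (ℕₚ.≤-irrelevant _ _)

open PartitionLists using (BDList↔BDPartition; count-BDList)
open Counting using (Counted-↔)

theorem1 : (t : ℕ) → 1 ≤ t → (n : ℕ) →
    Σ ℕ (λ k → (Fin k ↔ BDPartition n t) × (+ k ≡ RHS t n))
theorem1 t 1≤t n = Counted-↔ (BDList↔BDPartition t n) (count-BDList t 1≤t n)
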